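{- Let $H$ be a finite hypergraph whose automorphism group acts transitively on its vertex set. Then the nim-value of the game \textsc{Nofil} played on $H$ is either $0$ or $1$.
   Context: \textsc{Nofil} on a hypergraph $H$ is the following impartial two-player game. Initially no vertex is played. The players alternate turns; on a turn the current player chooses a vertex that has not yet been played and whose addition to the set of played vertices does not make some hyperedge consist entirely of played vertices; that vertex becomes played (regardless of which player chose it). A player with no legal move on their turn loses (normal play). The nim-value (Grundy value) of a position $X$ is defined recursively by $\mathcal{G}(X)=\operatorname{mex}\{\mathcal{G}(Y): Y \text{ is a position reachable from } X \text{ in one move}\}$, where $\operatorname{mex}(S)$ is the least non-negative integer not in $S$ (so a position with no moves has nim-value $0$); the nim-value of the game is the nim-value of its initial position. -}

module Defs where

open import Data.Nat using (ℕ; zero; suc)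
open import Data.Bool using (T?; Bool; true; false; if_then_else_; not; _∧_; _∨_)
open import Data.Fin using (Fin)
open import Data.Fin.Subset using (Subset; ⊥; _∪_; ⁅_⁆)
open import Data.Fin.Permutation using (Permutation′; _⟨$⟩ʳ_; _⟨$⟩ˡ_)
open import Data.Vec using (Vec; lookup; tabulate; foldr; zipWith; toList)
open import Data.List using (List; []; _∷_; length; filter; map; allFin)
open import Data.Bool.ListAction using (any)
open import Data.List.Membership.Propositional using (_∈_)
open import Data.Product using (Σ; _×_)
open import Data.Nat using (_≡ᵇ_)
open import Relation.Binary.PropositionalEquality using (_≡_)
open import Relation.Nullary.Decidable using (does)
open import Relation.Nullary using (¬_)
open import Function using (_⇔_)

record Hypergraph (n : ℕ) : Set where
  field
    edges : List (Subset n)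

open Hypergraph public

image : ∀ {n} → Permutation′ n → Subset n → Subset n
image σ e = tabulate (λ i → lookup e (σ ⟨$⟩ˡ i))

IsAutomorphism : ∀ {n} → Hypergraph n → Permutation′ n → Set
IsAutomorphism {n} H σ = ∀ (e : Subset n) → (e ∈ edges H) ⇔ (image σ e ∈ edges H)

VertexTransitive : ∀ {n} → Hypergraph n → Set
VertexTransitive {n} H =
  ∀ (u v : Fin n) → Σ (Permutation′ n) (λ σ → IsAutomorphism H σ × (σ ⟨$⟩ʳ u ≡ v))

subsetᵇ : ∀ {n} → Subset n → Subset n → Bool
subsetᵇ e X = foldr _ _∧_ true (zipWith (λ a b → not a ∨ b) e X)

-- Vertex v is a legal move in position X (set of played vertices):
-- v is not yet played, and no hyperedge is contained in X ∪ {v}.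
legalᵇ : ∀ {n} → Hypergraph n → Subset n → Fin n → Bool
legalᵇ H X v = not (lookup X v) ∧ not (any (λ e → subsetᵇ e (X ∪ ⁅ v ⁆)) (edges H))

moves : ∀ {n} → Hypergraph n → Subset n → List (Subset n)
moves {n} H X = map (λ v → X ∪ ⁅ v ⁆) (filter (λ v → T? (legalᵇ H X v)) (allFin n))

elemᵇ : ℕ → List ℕ → Bool
elemᵇ k xs = any (k ≡ᵇ_) xs

mexAux : ℕ → ℕ → List ℕ → ℕ
mexAux zero    k xs = k
mexAux (suc f) k xs = if elemᵇ k xs then mexAux f (suc k) xs else k

-- mex xs ≤ length xs, so length xs + 1 search steps suffice.
mex : List ℕ → ℕ
mex xs = mexAux (suc (length xs)) 0 xs

-- Grundy value with fuel; every move adds one vertex, so from any position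
-- at most n further moves are possible and fuel n is enough from the start.
grundyF : ∀ {n} → Hypergraph n → ℕ → Subset n → ℕ
grundyF H zero    X = 0
grundyF H (suc k) X = mex (map (grundyF H k) (moves H X))

nofilValue : ∀ {n} → Hypergraph n → ℕ
nofilValue {n} H = grundyF H n ⊥

-- An automorphism σ of H maps the legal moves from X bijectively onto the
-- legal moves from σ X, so by induction on the recursion depth it preserves
-- Grundy values.  In a vertex-transitive hypergraph any two opening moves {u}
-- and {v} are related by an automorphism, so all options of the empty position
-- share one Grundy value g, and the mex of a set containing only g is 0 or 1.
module Submission where

open import Defs
open import Data.Nat using (ℕ; zero; suc; _+_; _≤_; _<_; z≤n; s≤s)
open import Data.Nat.Properties
  using (≡ᵇ⇒≡; ≡⇒≡ᵇ; +-identityʳ; +-suc; <-irrefl; ≮⇒≥; ≤-trans; m≤n⇒m<n∨m≡n; <-cmp)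
open import Data.Sum using (_⊎_; inj₁; inj₂)
open import Data.Sum.Function.Propositional using (_⊎-⇔_)
open import Data.Product using (∃; _×_; _,_; proj₂)
open import Data.Bool using (true; false; T; T?; not; _∧_)
open import Data.Bool.ListAction using (any)
open import Data.Bool.Properties using (T-≡; ⇔→≡)
open import Data.Empty using (⊥-elim)
import Data.Fin as Fin
open import Data.Fin.Properties using (pigeonhole; toℕ<n)
open import Data.Fin.Subset using (Subset; ⊥; _∪_; ⁅_⁆)
  renaming (_∈_ to _∈ₛ_; _⊆_ to _⊆ₛ_)
open import Data.Fin.Subset.Properties using (⊆-antisym; drop-∷-⊆; ∉⊥; ∪⇔⊎; x∈⁅y⁆⇔x≡y)
open import Data.Fin.Permutation
  using (Permutation′; _⟨$⟩ʳ_; _⟨$⟩ˡ_; flip; inverseˡ; inverseʳ)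
open import Data.Vec using ([]; _∷_; lookup)
open import Data.Vec.Properties using (lookup∘tabulate; []=⇒lookup; lookup⇒[]=)
open import Data.Vec.Base using (here; there)
open import Data.List using (List; length; map; allFin)
import Data.List as List
open import Data.List.Relation.Unary.Any using (Any; index)
import Data.List.Relation.Unary.Any as Any
open import Data.List.Relation.Unary.Any.Properties using (any⇔; lookup-index)
open import Data.List.Membership.Propositional using (_∈_; _∉_; find; lose)
open import Data.List.Membership.Propositional.Properties
  using (∈-map⁺; ∈-map⁻; ∈-filter⁺; ∈-filter⁻; ∈-allFin)
open import Function using (_⇔_; mk⇔; Equivalence; _∘_; case_of_)
import Function.Properties.Equivalence as ⇔
open import Function.Related.Propositional using (module EquationalReasoning; equivalence)
open import Relation.Binary.Definitions using (tri<; tri≈; tri>)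
open import Relation.Binary.PropositionalEquality using (_≡_; refl; sym; trans; cong; cong₂; subst)

open Equivalence using (to; from)

T-⇔⇒≡ : ∀ {a b} → T a ⇔ T b → a ≡ b
T-⇔⇒≡ Ta⇔Tb = ⇔→≡ (⇔.trans (⇔.sym T-≡) (⇔.trans Ta⇔Tb T-≡))

elemᵇ⇔∈ : ∀ {k xs} → T (elemᵇ k xs) ⇔ k ∈ xs
elemᵇ⇔∈ {k} = ⇔.trans (⇔.sym any⇔) (mk⇔ (Any.map (≡ᵇ⇒≡ k _)) (Any.map (≡⇒≡ᵇ k _)))

mexAux-below : ∀ f k xs {j} → k ≤ j → j < mexAux f k xs → j ∈ xs
mexAux-below zero    k xs k≤j j<k = ⊥-elim (<-irrefl refl (≤-trans j<k k≤j))
mexAux-below (suc f) k xs k≤j j<mex with elemᵇ k xs in k∈xs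
... | false = ⊥-elim (<-irrefl refl (≤-trans j<mex k≤j))
... | true with m≤n⇒m<n∨m≡n k≤j
...   | inj₁ k<j  = mexAux-below f (suc k) xs k<j j<mex
...   | inj₂ refl = to elemᵇ⇔∈ (from T-≡ k∈xs)

mexAux-exhausted : ∀ f k xs → mexAux f k xs ∈ xs → mexAux f k xs ≡ k + f
mexAux-exhausted zero    k xs _ = sym (+-identityʳ k)
mexAux-exhausted (suc f) k xs mex∈xs with elemᵇ k xs in k∈xs
... | false = ⊥-elim (subst T k∈xs (from elemᵇ⇔∈ mex∈xs))
... | true  = trans (mexAux-exhausted f (suc k) xs mex∈xs) (sym (+-suc k f))

∈-below⇒≤length : ∀ {n} (xs : List ℕ) → (∀ {j} → j < n → j ∈ xs) → n ≤ length xs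
∈-below⇒≤length xs below = ≮⇒≥ λ length<n →
  let i , j , i<j , same-index = pigeonhole length<n (index ∘ below ∘ toℕ<n)
      toℕi≡toℕj = trans (lookup-index (below (toℕ<n i)))
                    (trans (cong (List.lookup xs) same-index) (sym (lookup-index (below (toℕ<n j)))))
  in <-irrefl toℕi≡toℕj i<j

mex-minimal : ∀ xs {j} → j < mex xs → j ∈ xs
mex-minimal xs = mexAux-below (suc (length xs)) 0 xs z≤n

mex∉ : ∀ xs → mex xs ∉ xs
mex∉ xs mex∈xs = <-irrefl refl (∈-below⇒≤length xs λ j<1+length →
  mex-minimal xs (subst (_ <_) (sym (mexAux-exhausted (suc (length xs)) 0 xs mex∈xs)) j<1+length))

mex-cong : ∀ {xs ys} → (∀ {j} → j ∈ xs ⇔ j ∈ ys) → mex xs ≡ mex ys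
mex-cong {xs} {ys} same with <-cmp (mex xs) (mex ys)
... | tri< lt _ _ = ⊥-elim (mex∉ xs (from same (mex-minimal ys lt)))
... | tri≈ _ eq _ = eq
... | tri> _ _ gt = ⊥-elim (mex∉ ys (to same (mex-minimal xs gt)))

mex-all-equal : ∀ xs → (∀ {a b} → a ∈ xs → b ∈ xs → a ≡ b) → mex xs ≡ 0 ⊎ mex xs ≡ 1
mex-all-equal xs all-equal with mex xs | mex-minimal xs
... | zero          | _     = inj₁ refl
... | suc zero      | _     = inj₂ refl
... | suc (suc _)   | below with all-equal (below (s≤s z≤n)) (below (s≤s (s≤s z≤n)))
... | ()

∈-ext : ∀ {n} {p q : Subset n} → (∀ {x} → x ∈ₛ p ⇔ x ∈ₛ q) → p ≡ q
∈-ext same = ⊆-antisym (to same) (from same)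

subsetᵇ⇔⊆ : ∀ {n} (e X : Subset n) → T (subsetᵇ e X) ⇔ e ⊆ₛ X
subsetᵇ⇔⊆ []          []          = mk⇔ (λ _ ()) _
subsetᵇ⇔⊆ (false ∷ e) (_ ∷ X)     = mk⇔
  (λ e⊆X → λ { {Fin.zero} () ; (there x∈e) → there (to (subsetᵇ⇔⊆ e X) e⊆X x∈e) })
  (from (subsetᵇ⇔⊆ e X) ∘ drop-∷-⊆)
subsetᵇ⇔⊆ (true ∷ e)  (true ∷ X)  = mk⇔
  (λ e⊆X → λ { here → here ; (there x∈e) → there (to (subsetᵇ⇔⊆ e X) e⊆X x∈e) })
  (from (subsetᵇ⇔⊆ e X) ∘ drop-∷-⊆)
subsetᵇ⇔⊆ (true ∷ e)  (false ∷ X) = mk⇔ (λ ()) (λ e⊆X → case e⊆X here of λ ())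

lookup-image : ∀ {n} (σ : Permutation′ n) e i → lookup (image σ e) i ≡ lookup e (σ ⟨$⟩ˡ i)
lookup-image σ e = lookup∘tabulate (lookup e ∘ (σ ⟨$⟩ˡ_))

∈-image : ∀ {n} (σ : Permutation′ n) e {x} → x ∈ₛ image σ e ⇔ σ ⟨$⟩ˡ x ∈ₛ e
∈-image σ e {x} = mk⇔
  (λ x∈σe → lookup⇒[]= _ e (trans (sym (lookup-image σ e x)) ([]=⇒lookup x∈σe)))
  (λ σx∈e → lookup⇒[]= x _ (trans (lookup-image σ e x) ([]=⇒lookup σx∈e)))

module _ {n} (σ : Permutation′ n) where

  image-⊥ : image σ ⊥ ≡ ⊥
  image-⊥ = ∈-ext (mk⇔ (⊥-elim ∘ ∉⊥ ∘ to (∈-image σ ⊥)) (⊥-elim ∘ ∉⊥))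

  image-∪ : ∀ p q → image σ (p ∪ q) ≡ image σ p ∪ image σ q
  image-∪ p q = ∈-ext λ {x} → begin
    x ∈ₛ image σ (p ∪ q)                  ∼⟨ ∈-image σ (p ∪ q) ⟩
    σ ⟨$⟩ˡ x ∈ₛ p ∪ q                      ∼⟨ ∪⇔⊎ ⟩
    (σ ⟨$⟩ˡ x ∈ₛ p ⊎ σ ⟨$⟩ˡ x ∈ₛ q)          ∼⟨ ⇔.sym (∈-image σ p) ⊎-⇔ ⇔.sym (∈-image σ q) ⟩
    (x ∈ₛ image σ p ⊎ x ∈ₛ image σ q)      ∼⟨ ⇔.sym ∪⇔⊎ ⟩
    x ∈ₛ image σ p ∪ image σ q            ∎
    where open EquationalReasoning {k = equivalence}

  image-⁅⁆ : ∀ v → image σ ⁅ v ⁆ ≡ ⁅ σ ⟨$⟩ʳ v ⁆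
  image-⁅⁆ v = ∈-ext λ {x} → begin
    x ∈ₛ image σ ⁅ v ⁆    ∼⟨ ∈-image σ ⁅ v ⁆ ⟩
    σ ⟨$⟩ˡ x ∈ₛ ⁅ v ⁆      ∼⟨ x∈⁅y⁆⇔x≡y ⟩
    σ ⟨$⟩ˡ x ≡ v          ∼⟨ mk⇔ (λ { refl → sym (inverseʳ σ) }) (λ { refl → inverseˡ σ }) ⟩
    x ≡ σ ⟨$⟩ʳ v          ∼⟨ ⇔.sym x∈⁅y⁆⇔x≡y ⟩
    x ∈ₛ ⁅ σ ⟨$⟩ʳ v ⁆      ∎
    where open EquationalReasoning {k = equivalence}

  image-∪-⁅⁆ : ∀ X v → image σ (X ∪ ⁅ v ⁆) ≡ image σ X ∪ ⁅ σ ⟨$⟩ʳ v ⁆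
  image-∪-⁅⁆ X v = trans (image-∪ X ⁅ v ⁆) (cong (image σ X ∪_) (image-⁅⁆ v))

  image-flip : ∀ e → image σ (image (flip σ) e) ≡ e
  image-flip e = ∈-ext λ {x} → begin
    x ∈ₛ image σ (image (flip σ) e)      ∼⟨ ∈-image σ (image (flip σ) e) ⟩
    σ ⟨$⟩ˡ x ∈ₛ image (flip σ) e          ∼⟨ ∈-image (flip σ) e ⟩
    σ ⟨$⟩ʳ (σ ⟨$⟩ˡ x) ∈ₛ e                  ∼⟨ mk⇔ (subst (_∈ₛ e) (inverseʳ σ)) (subst (_∈ₛ e) (sym (inverseʳ σ))) ⟩
    x ∈ₛ e                              ∎
    where open EquationalReasoning {k = equivalence}

  ⊆-image : ∀ {e X} → e ⊆ₛ X ⇔ image σ e ⊆ₛ image σ X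
  ⊆-image {e} {X} = mk⇔ forward backward
    where
    forward : e ⊆ₛ X → image σ e ⊆ₛ image σ X
    forward e⊆X x∈σe = from (∈-image σ X) (e⊆X (to (∈-image σ e) x∈σe))

    backward : image σ e ⊆ₛ image σ X → e ⊆ₛ X
    backward σe⊆σX x∈e = subst (_∈ₛ X) (inverseˡ σ)
      (to (∈-image σ X) (σe⊆σX (from (∈-image σ e) (subst (_∈ₛ e) (sym (inverseˡ σ)) x∈e))))

ContainsEdge : ∀ {n} → Hypergraph n → Subset n → Set
ContainsEdge H Y = Any (_⊆ₛ Y) (edges H)

T-any-subsetᵇ⇔ContainsEdge : ∀ {n} (H : Hypergraph n) Y →
  T (any (λ e → subsetᵇ e Y) (edges H)) ⇔ ContainsEdge H Y
T-any-subsetᵇ⇔ContainsEdge H Y = ⇔.trans (⇔.sym any⇔)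
  (mk⇔ (Any.map λ {e} → to (subsetᵇ⇔⊆ e Y)) (Any.map λ {e} → from (subsetᵇ⇔⊆ e Y)))

∈-moves⁻ : ∀ {n} (H : Hypergraph n) {X Y} → Y ∈ moves H X → ∃ λ v → T (legalᵇ H X v) × Y ≡ X ∪ ⁅ v ⁆
∈-moves⁻ {n} H {X} Y∈ with v , v∈ , refl ← ∈-map⁻ (λ v → X ∪ ⁅ v ⁆) Y∈ =
  v , proj₂ (∈-filter⁻ (λ v → T? (legalᵇ H X v)) {xs = allFin n} v∈) , refl

∈-moves⁺ : ∀ {n} (H : Hypergraph n) {X v} → T (legalᵇ H X v) → X ∪ ⁅ v ⁆ ∈ moves H X
∈-moves⁺ H {X} {v} legal =
  ∈-map⁺ (λ v → X ∪ ⁅ v ⁆) (∈-filter⁺ (λ v → T? (legalᵇ H X v)) (∈-allFin v) legal)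

module _ {n} (H : Hypergraph n) (σ : Permutation′ n) (aut : IsAutomorphism H σ) where

  ContainsEdge-image : ∀ Y → ContainsEdge H (image σ Y) ⇔ ContainsEdge H Y
  ContainsEdge-image Y = mk⇔ forward backward
    where
    forward : ContainsEdge H (image σ Y) → ContainsEdge H Y
    forward edge⊆σY =
      let e , e∈H , e⊆σY = find edge⊆σY
          d = image (flip σ) e
      in lose (from (aut d) (subst (_∈ edges H) (sym (image-flip σ e)) e∈H))
              (from (⊆-image σ {d}) (subst (_⊆ₛ image σ Y) (sym (image-flip σ e)) e⊆σY))

    backward : ContainsEdge H Y → ContainsEdge H (image σ Y)
    backward edge⊆Y =
      let e , e∈H , e⊆Y = find edge⊆Y in lose (to (aut e) e∈H) (to (⊆-image σ) e⊆Y)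

  legalᵇ-image : ∀ X v → legalᵇ H (image σ X) (σ ⟨$⟩ʳ v) ≡ legalᵇ H X v
  legalᵇ-image X v = cong₂ (λ played filled → not played ∧ not filled) played-image filled-image
    where
    played-image : lookup (image σ X) (σ ⟨$⟩ʳ v) ≡ lookup X v
    played-image = trans (lookup-image σ X (σ ⟨$⟩ʳ v)) (cong (lookup X) (inverseˡ σ))

    filled-image : any (λ e → subsetᵇ e (image σ X ∪ ⁅ σ ⟨$⟩ʳ v ⁆)) (edges H)
                 ≡ any (λ e → subsetᵇ e (X ∪ ⁅ v ⁆)) (edges H)
    filled-image = T-⇔⇒≡ (⇔.trans (T-any-subsetᵇ⇔ContainsEdge H _)
      (⇔.trans (subst (λ Y → ContainsEdge H Y ⇔ _) (image-∪-⁅⁆ σ X v) (ContainsEdge-image (X ∪ ⁅ v ⁆)))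
               (⇔.sym (T-any-subsetᵇ⇔ContainsEdge H _))))

  image-∈-moves : ∀ {X Y} → Y ∈ moves H X → image σ Y ∈ moves H (image σ X)
  image-∈-moves {X} Y∈ with v , legal , refl ← ∈-moves⁻ H Y∈ =
    subst (_∈ moves H (image σ X)) (sym (image-∪-⁅⁆ σ X v))
      (∈-moves⁺ H (subst T (sym (legalᵇ-image X v)) legal))

  ∈-moves-image : ∀ {X Z} → Z ∈ moves H (image σ X) → ∃ λ Y → Y ∈ moves H X × image σ Y ≡ Z
  ∈-moves-image {X} Z∈ with w , legal , refl ← ∈-moves⁻ H Z∈ =
    X ∪ ⁅ σ ⟨$⟩ˡ w ⁆ , ∈-moves⁺ H legal′ ,
    trans (image-∪-⁅⁆ σ X (σ ⟨$⟩ˡ w)) (cong (λ u → image σ X ∪ ⁅ u ⁆) (inverseʳ σ))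
    where
    legal′ : T (legalᵇ H X (σ ⟨$⟩ˡ w))
    legal′ = subst T (trans (cong (legalᵇ H (image σ X)) (sym (inverseʳ σ)))
                            (legalᵇ-image X (σ ⟨$⟩ˡ w))) legal

  grundyF-image : ∀ k X → grundyF H k (image σ X) ≡ grundyF H k X
  grundyF-image zero    X = refl
  grundyF-image (suc k) X = mex-cong (mk⇔ backward forward)
    where
    forward : ∀ {j} → j ∈ map (grundyF H k) (moves H X) → j ∈ map (grundyF H k) (moves H (image σ X))
    forward j∈ with Y , Y∈ , refl ← ∈-map⁻ (grundyF H k) j∈ =
      subst (_∈ _) (grundyF-image k Y) (∈-map⁺ (grundyF H k) (image-∈-moves Y∈))

    backward : ∀ {j} → j ∈ map (grundyF H k) (moves H (image σ X)) → j ∈ map (grundyF H k) (moves H X)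
    backward j∈ with Z , Z∈ , refl ← ∈-map⁻ (grundyF H k) j∈
                with Y , Y∈ , refl ← ∈-moves-image Z∈ =
      subst (_∈ _) (sym (grundyF-image k Y)) (∈-map⁺ (grundyF H k) Y∈)

module _ {n} (H : Hypergraph n) (transitive : VertexTransitive H) where

  opening-moves-conjugate : ∀ {Y Z} → Y ∈ moves H ⊥ → Z ∈ moves H ⊥ →
    ∃ λ σ → IsAutomorphism H σ × image σ Y ≡ Z
  opening-moves-conjugate Y∈ Z∈
    with u , _ , refl ← ∈-moves⁻ H Y∈ | v , _ , refl ← ∈-moves⁻ H Z∈
    with σ , aut , refl ← transitive u v =
    σ , aut , trans (image-∪-⁅⁆ σ ⊥ u) (cong (_∪ ⁅ σ ⟨$⟩ʳ u ⁆) (image-⊥ σ))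

  opening-values-equal : ∀ k {a b} →
    a ∈ map (grundyF H k) (moves H ⊥) → b ∈ map (grundyF H k) (moves H ⊥) → a ≡ b
  opening-values-equal k a∈ b∈
    with Y , Y∈ , refl ← ∈-map⁻ (grundyF H k) a∈ | Z , Z∈ , refl ← ∈-map⁻ (grundyF H k) b∈
    with σ , aut , refl ← opening-moves-conjugate Y∈ Z∈ = sym (grundyF-image H σ aut k Y)

proposition2p1 : ∀ (n : ℕ) (H : Hypergraph n) → VertexTransitive H →
    (nofilValue H ≡ 0) ⊎ (nofilValue H ≡ 1)
proposition2p1 zero    H _          = inj₁ refl
proposition2p1 (suc n) H transitive = mex-all-equal _ (opening-values-equal H transitive n)
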